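{- For $t\in\{e,p\}$ and every integer $v\ge1$, there is a polynomial $P^t_v\in\mathbb Q[d]$ of degree exactly $\lfloor\log_2 v\rfloor$ such that $n^t_v(d)=P^t_v(d)$ for all integers $d\ge0$. That is, the number of $(d+1)$-espaliers of volume $v$ and the number of $(d+1)$-pyramids of volume $v$ are both polynomials in $d$ of degree $\lfloor\log_2 v\rfloor$.
   Context: Let $d\ge1$. A $(d+1)$-pyramid of height $h\ge1$ is a finite set of unit cells of $\mathbb Z^{d+1}$ (a cell identified with its smallest vertex) of the form $\bigcup_{a=0}^{h-1}\{a\}\times B_a$, where each $B_a=\prod_{k=1}^d\{b_{a,k},\dots,b_{a,k}+\ell_{a,k}-1\}\subset\mathbb Z^d$ is a nonempty box of cells ($\ell_{a,k}\ge1$), $b_{0,k}=0$ for all $k$, and $B_a\subseteq B_{a-1}$ for $1\le a\le h-1$. A $(d+1)$-espalier is a $(d+1)$-pyramid with $b_{a,k}=0$ for all $a,k$ (each plateau contains the cell $(a,0,\dots,0)$). The volume is the total number of cells. For $t=e$ (espaliers) or $t=p$ (pyramids), $n^t_v(d)$ is the number of $(d+1)$-espaliers, resp. $(d+1)$-pyramids, of volume $v$ (of any height). By convention $n^t_v(0)=1$ for all $v\ge1$. -}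

module Defs where

open import Data.Nat as ℕ using (ℕ; zero; suc)
open import Data.Integer as ℤ using (ℤ; +_)
open import Data.Rational as ℚ using (ℚ)
open import Data.Product using (_×_; _,_; proj₁; proj₂)
open import Data.Unit using (⊤)
open import Data.Vec as Vec using (Vec)
open import Data.Vec.Relation.Unary.All as VAll using ()
open import Data.Vec.Relation.Binary.Pointwise.Inductive using (Pointwise)
open import Data.List as List using (List; _∷_)
open import Data.List.Relation.Unary.All as LAll using ()
open import Data.List.Relation.Unary.Linked using (Linked)
open import Data.Nat.ListAction using (sum)
open import Relation.Binary.PropositionalEquality using (_≡_)

-- t ∈ {e, p}: espaliers or pyramids
data Kind : Set where
  e p : Kind

-- A box of cells in ℤ^d: for each coordinate k, the pair (b_k , ℓ_k),
-- meaning the cells {b_k, …, b_k + ℓ_k - 1}.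
Box : ℕ → Set
Box d = Vec (ℤ × ℕ) d

IsBox : ∀ {d} → Box d → Set
IsBox B = VAll.All (λ c → 1 ℕ.≤ proj₂ c) B

_⊆Box_ : ∀ {d} → Box d → Box d → Set
inner ⊆Box outer =
  Pointwise (λ c' c → (proj₁ c ℤ.≤ proj₁ c')
                     × (proj₁ c' ℤ.+ + proj₂ c' ℤ.≤ proj₁ c ℤ.+ + proj₂ c))
            inner outer

Anchored : ∀ {d} → Box d → Set
Anchored B = VAll.All (λ c → proj₁ c ≡ + 0) B

cells : ∀ {d} → Box d → ℕ
cells B = Vec.foldr _ (λ c acc → proj₂ c ℕ.* acc) 1 B

KindCond : Kind → ∀ {d} → List (Box d) → Set
KindCond e bs = LAll.All Anchored bs
KindCond p bs = ⊤

-- A (d+1)-pyramid (t = p) / espalier (t = e) of volume v.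
-- Plateaus B_0 = base, B_1, …, B_{h-1} = upper (height h = 1 + length upper ≥ 1).
record Structure (t : Kind) (d v : ℕ) : Set where
  constructor mkStructure
  field
    base     : Box d
    upper    : List (Box d)
    boxes    : LAll.All IsBox (base ∷ upper)
    anchored : Anchored base
    nested   : Linked (λ outer inner → inner ⊆Box outer) (base ∷ upper)
    kindCond : KindCond t (base ∷ upper)
    volume   : sum (List.map cells (base ∷ upper)) ≡ v

-- polynomials over ℚ as coefficient vectors (constant term first)
evalPoly : ∀ {n} → Vec ℚ n → ℚ → ℚ
evalPoly cs x = Vec.foldr _ (λ c acc → c ℚ.+ x ℚ.* acc) ℚ.0ℚ cs

ℕtoℚ : ℕ → ℚ
ℕtoℚ n = + n ℚ./ 1

-- Call a direction k of a structure thick if its base has side ≥ 2 there, thin if the side is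
-- 1.  In a thin direction every plateau (being nonempty and inside the base) has offset 0 and side 1,
-- so the direction can be deleted.  Writing T k n for the structures of dimension k + n whose first
-- k directions are thick, and deciding the next direction, gives a bijection
--     T k (n + 1)  ≅  T k n ⊎ T (k + 1) n,
-- hence  #structures of dimension d = Σ_j C(d, j) · a j  with  a j = #T j 0  (fully thick ones).
-- A fully thick base of dimension j has ≥ 2^j cells, so a j = 0 for j > L = ⌊log₂ v⌋, while a L ≥ 1
-- (a 2×⋯×2 cube under v − 2^L unit cubes).  Finally d ↦ Σ_{j ≤ L} C(d, j) · a j is given by a
-- Newton polynomial of degree L with leading coefficient a L / L! ≠ 0.
module Submission where

open import Defs
open import Data.Nat using (ℕ; suc; _≤_)
open import Data.Nat.Logarithm using (⌊log₂_⌋)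
open import Data.Rational using (ℚ; 0ℚ)
open import Data.Vec using (Vec; last)
open import Data.Fin using (Fin)
open import Data.Product using (Σ; _×_)
open import Function.Bundles using (_↔_)
open import Relation.Nullary using (¬_)
open import Relation.Binary.PropositionalEquality using (_≡_)

import Axiom.UniquenessOfIdentityProofs as UIP
open import Data.Empty using (⊥; ⊥-elim)
open import Data.Fin as F using ()
import Data.Fin.Properties as FP
open import Data.Integer as ℤ using (ℤ; +_; -[1+_])
import Data.Integer.Properties as ℤP
import Data.Integer.Solver
open import Data.List as List using (List; []; _∷_; length)
import Data.List.Properties as ListP
open import Data.List.Relation.Unary.All as LAll using ([]; _∷_)
import Data.List.Relation.Unary.All.Properties as AllP
open import Data.List.Relation.Unary.Linked as Linked using (Linked; []; [-]; _∷_)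
import Data.List.Relation.Unary.Linked.Properties as LinkedP
open import Data.Maybe using (Maybe; just; nothing)
import Data.Maybe.Properties as MP
open import Data.Nat as ℕ using (zero; _+_; _*_; _^_; _∸_; _<_; z≤n; s≤s; ⌊_/2⌋; _!)
open import Data.Nat.Coprimality as Coprime using (1-coprimeTo)
open import Data.Nat.DivMod using (_mod_; m≤n⇒m%n≡m)
open import Data.Nat.Induction using (<-rec)
open import Data.Nat.ListAction using (sum)
open import Data.Nat.Logarithm using (⌊log₂⌋-mono-≤; ⌊log₂[2^n]⌋≡n; ⌊log₂⌊n/2⌋⌋≡⌊log₂n⌋∸1)
import Data.Nat.Properties as ℕP
open import Algebra.Properties.CommutativeSemigroup ℕP.*-commutativeSemigroup using (x∙yz≈y∙xz)
import Data.Nat.Solver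
open import Data.Product using (_,_; proj₁; proj₂)
open import Data.Product.Function.NonDependent.Propositional using (_×-↔_)
import Data.Product.Properties as ×P
open import Data.Rational as ℚ using (mkℚ; 1ℚ)
import Data.Rational.Properties as ℚP
import Data.Rational.Solver
import Data.Rational.Unnormalised as U
import Data.Rational.Unnormalised.Properties as UP
open import Data.Sum using (_⊎_; inj₁; inj₂)
open import Data.Sum.Function.Propositional using (_⊎-↔_)
open import Data.Unit using (⊤; tt)
open import Data.Vec as Vec using ([]; _∷_)
import Data.Vec.Properties as VP
open import Data.Vec.Relation.Binary.Pointwise.Inductive as PW using (Pointwise; []; _∷_)
open import Data.Vec.Relation.Unary.All as VAll using ([]; _∷_)
open import Function.Base using (_∘_)
open import Function.Bundles using (mk↔ₛ′; Inverse)
open import Function.Properties.Inverse using (↔-refl; ↔-sym; ↔-trans)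
open import Relation.Binary using (DecidableEquality)
open import Relation.Binary.PropositionalEquality
  using (refl; sym; trans; cong; cong₂; subst; module ≡-Reasoning)
open import Relation.Nullary using (Dec; yes; no; Irrelevant)
open import Relation.Nullary.Decidable using (_×-dec_)

module NS = Data.Nat.Solver.+-*-Solver
module ZS = Data.Integer.Solver.+-*-Solver
module QS = Data.Rational.Solver.+-*-Solver

Finite : Set → Set
Finite A = Σ ℕ λ N → Fin N ↔ A

finite-↔ : ∀ {A B : Set} → A ↔ B → Finite A → Finite B
finite-↔ A↔B (N , enum) = N , ↔-trans enum A↔B

finite-⊤ : Finite ⊤
finite-⊤ = 1 , FP.1↔⊤

finite-⊎ : ∀ {A B : Set} → Finite A → Finite B → Finite (A ⊎ B)
finite-⊎ (m , f) (n , g) = m + n , ↔-trans FP.+↔⊎ (f ⊎-↔ g)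

finite-× : ∀ {A B : Set} → Finite A → Finite B → Finite (A × B)
finite-× (m , f) (n , g) = m * n , ↔-trans FP.*↔× (f ×-↔ g)

finite-Vec : ∀ {A : Set} → Finite A → ∀ n → Finite (Vec A n)
finite-Vec fA zero = finite-↔ (mk↔ₛ′ (λ _ → []) (λ _ → tt) (λ { [] → refl }) (λ _ → refl)) finite-⊤
finite-Vec {A} fA (suc n) = finite-↔ cons↔ (finite-× fA (finite-Vec fA n))
  where
  cons↔ : (A × Vec A n) ↔ Vec A (suc n)
  cons↔ = mk↔ₛ′ (λ { (x , xs) → x ∷ xs }) (λ { (x ∷ xs) → x , xs }) (λ { (x ∷ xs) → refl }) (λ { (x , xs) → refl })

finite-Maybe : ∀ {A : Set} → Finite A → Finite (Maybe A)
finite-Maybe {A} fA = finite-↔ ⊤⊎↔Maybe (finite-⊎ finite-⊤ fA)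
  where
  ⊤⊎↔Maybe : (⊤ ⊎ A) ↔ Maybe A
  ⊤⊎↔Maybe = mk↔ₛ′ (λ { (inj₁ _) → nothing ; (inj₂ a) → just a }) (λ { nothing → inj₁ tt ; (just a) → inj₂ a })
    (λ { nothing → refl ; (just a) → refl }) (λ { (inj₁ tt) → refl ; (inj₂ a) → refl })

finite-empty : ∀ {A : Set} (fA : Finite A) → ¬ A → proj₁ fA ≡ 0
finite-empty (zero , _) _ = refl
finite-empty (suc N , enum) ¬a = ⊥-elim (¬a (Inverse.to enum F.zero))

finite-inhabited : ∀ {A : Set} (fA : Finite A) → A → 1 ≤ proj₁ fA
finite-inhabited (zero , enum) a = ⊥-elim (FP.¬Fin0 (Inverse.from enum a))
finite-inhabited (suc N , _) _ = s≤s z≤n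

Σ-≡-irrelevant : ∀ {A : Set} {P : A → Set} → (∀ a → Irrelevant (P a)) →
                 ∀ {a a' pa pa'} → a ≡ a' → _≡_ {A = Σ A P} (a , pa) (a' , pa')
Σ-≡-irrelevant irr {a} {pa = pa} {pa'} refl = cong (a ,_) (irr a pa pa')

finite-prop : ∀ {P : Set} → Dec P → Irrelevant P → Finite P
finite-prop (yes x) irr = 1 , mk↔ₛ′ (λ _ → x) (λ _ → F.zero) (irr x) (λ { F.zero → refl ; (F.suc ()) })
finite-prop (no ¬p) irr = 0 , mk↔ₛ′ (λ ()) (λ pa → ⊥-elim (¬p pa)) (λ pa → ⊥-elim (¬p pa)) (λ ())

finite-ΣFin : ∀ M (Q : Fin M → Set) → (∀ i → Finite (Q i)) → Finite (Σ (Fin M) Q)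
finite-ΣFin zero Q _ = 0 , mk↔ₛ′ (λ ()) (λ { (() , _) }) (λ { (() , _) }) (λ ())
finite-ΣFin (suc M) Q fQ =
  finite-↔ (↔-sym peel) (finite-⊎ (fQ F.zero) (finite-ΣFin M (λ i → Q (F.suc i)) (λ i → fQ (F.suc i))))
  where
  peel : Σ (Fin (suc M)) Q ↔ (Q F.zero ⊎ Σ (Fin M) (λ i → Q (F.suc i)))
  peel = mk↔ₛ′ (λ { (F.zero , q) → inj₁ q ; (F.suc i , q) → inj₂ (i , q) })
               (λ { (inj₁ q) → F.zero , q ; (inj₂ (i , q)) → F.suc i , q })
               (λ { (inj₁ q) → refl ; (inj₂ (i , q)) → refl })
               (λ { (F.zero , q) → refl ; (F.suc i , q) → refl })

module _ {A B : Set} {P : A → Set} {Q : B → Set}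
  (irrP : ∀ a → Irrelevant (P a)) (irrQ : ∀ b → Irrelevant (Q b))
  (f : A → B) (g : B → A) (fP : ∀ a → P a → Q (f a)) (gQ : ∀ b → Q b → P (g b))
  (gf : ∀ a → P a → g (f a) ≡ a) (fg : ∀ b → Q b → f (g b) ≡ b) where

  subset-↔ : Σ A P ↔ Σ B Q
  subset-↔ = mk↔ₛ′ (λ { (a , pa) → f a , fP a pa }) (λ { (b , q) → g b , gQ b q })
    (λ { (b , q) → Σ-≡-irrelevant irrQ (fg b q) }) (λ { (a , pa) → Σ-≡-irrelevant irrP (gf a pa) })

finite-subset : ∀ {B : Set} {Q : B → Set} → Finite B → (∀ b → Dec (Q b)) → (∀ b → Irrelevant (Q b)) →
                Finite (Σ B Q)
finite-subset {B} {Q} (M , enum) decQ irrQ =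
  finite-↔ reindex (finite-ΣFin M (λ i → Q (to i)) (λ i → finite-prop (decQ (to i)) (irrQ (to i))))
  where
  open Inverse enum
  reindex : Σ (Fin M) (λ i → Q (to i)) ↔ Σ B Q
  reindex = subset-↔ (λ i → irrQ (to i)) irrQ to from (λ _ q → q)
              (λ b q → subst Q (sym (strictlyInverseˡ b)) q)
              (λ i _ → strictlyInverseʳ i) (λ b _ → strictlyInverseˡ b)

finite-encodable : ∀ {A B : Set} (P : A → Set) → Finite B → DecidableEquality B →
                   (enc : A → B) (dec : B → A) → (∀ a → P a → dec (enc a) ≡ a) →
                   (∀ a → Dec (P a)) → (∀ a → Irrelevant (P a)) → Finite (Σ A P)
finite-encodable {A} {B} P fB _≟_ enc dec dec-enc decP irrP = finite-↔ decode (finite-subset fB decCode irrCode)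
  where
  Code : B → Set
  Code b = P (dec b) × (enc (dec b) ≡ b)
  decCode : ∀ b → Dec (Code b)
  decCode b = decP (dec b) ×-dec (enc (dec b) ≟ b)
  irrCode : ∀ b → Irrelevant (Code b)
  irrCode b (pa , w) (pa' , w') = cong₂ _,_ (irrP _ pa pa') (UIP.Decidable⇒UIP.≡-irrelevant _≟_ w w')
  decode : Σ B Code ↔ Σ A P
  decode = subset-↔ irrCode irrP dec enc (λ _ → proj₁)
             (λ a pa → subst P (sym (dec-enc a pa)) pa , cong enc (dec-enc a pa))
             (λ _ → proj₂) dec-enc

module _ {A : Set} {P T₁ T₂ : A → Set}
  (irrP : ∀ a → Irrelevant (P a)) (irr₁ : ∀ a → Irrelevant (T₁ a)) (irr₂ : ∀ a → Irrelevant (T₂ a))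
  (dichotomy : ∀ a → P a → T₁ a ⊎ T₂ a) (exclusive : ∀ a → T₁ a → T₂ a → ⊥) where

  private
    Parts : Set
    Parts = Σ A (λ a → P a × T₁ a) ⊎ Σ A (λ a → P a × T₂ a)

    classify : ∀ a → P a → T₁ a ⊎ T₂ a → Parts
    classify a pa (inj₁ t) = inj₁ (a , pa , t)
    classify a pa (inj₂ t) = inj₂ (a , pa , t)

    forget : Parts → Σ A P
    forget (inj₁ (a , pa , _)) = a , pa
    forget (inj₂ (a , pa , _)) = a , pa

    forget-classify : ∀ a pa s → forget (classify a pa s) ≡ (a , pa)
    forget-classify a pa (inj₁ _) = refl
    forget-classify a pa (inj₂ _) = refl

    sort : Σ A P → Parts
    sort (a , pa) = classify a pa (dichotomy a pa)

    sort-forget : ∀ x → sort (forget x) ≡ x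
    sort-forget (inj₁ (a , pa , t)) with dichotomy a pa
    ... | inj₁ t' = cong (λ z → inj₁ (a , pa , z)) (irr₁ a t' t)
    ... | inj₂ t' = ⊥-elim (exclusive a t t')
    sort-forget (inj₂ (a , pa , t)) with dichotomy a pa
    ... | inj₁ t' = ⊥-elim (exclusive a t' t)
    ... | inj₂ t' = cong (λ z → inj₂ (a , pa , z)) (irr₂ a t' t)

  Σ-split : Σ A P ↔ Parts
  Σ-split = mk↔ₛ′ sort forget sort-forget
                  (λ { (a , pa) → forget-classify a pa (dichotomy a pa) })

×-irrelevant : ∀ {P Q : Set} → Irrelevant P → Irrelevant Q → Irrelevant (P × Q)
×-irrelevant irrP irrQ (x , y) (x' , y') = cong₂ _,_ (irrP x x') (irrQ y y')

pointwise-irrelevant : ∀ {A B : Set} {R : A → B → Set} → (∀ {x y} → Irrelevant (R x y)) →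
                       ∀ {m n} {xs : Vec A m} {ys : Vec B n} → Irrelevant (Pointwise R xs ys)
pointwise-irrelevant irr [] [] = refl
pointwise-irrelevant irr (r ∷ rs) (r' ∷ rs') = cong₂ _∷_ (irr r r') (pointwise-irrelevant irr rs rs')

CoordWithin : ℤ × ℕ → ℤ × ℕ → Set
CoordWithin c' c = (proj₁ c ℤ.≤ proj₁ c') × (proj₁ c' ℤ.+ + proj₂ c' ℤ.≤ proj₁ c ℤ.+ + proj₂ c)

Contains : ∀ {d} → Box d → Box d → Set
Contains outer inner = inner ⊆Box outer

coordWithin-irrelevant : ∀ {c' c} → Irrelevant (CoordWithin c' c)
coordWithin-irrelevant = ×-irrelevant ℤP.≤-irrelevant ℤP.≤-irrelevant

coordWithin? : ∀ c' c → Dec (CoordWithin c' c)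
coordWithin? c' c = (proj₁ c ℤP.≤? proj₁ c') ×-dec (proj₁ c' ℤ.+ + proj₂ c' ℤP.≤? proj₁ c ℤ.+ + proj₂ c)

contains-irrelevant : ∀ {d} {outer inner : Box d} → Irrelevant (Contains outer inner)
contains-irrelevant = pointwise-irrelevant coordWithin-irrelevant

contains? : ∀ {d} (outer inner : Box d) → Dec (Contains outer inner)
contains? outer inner = PW.decidable coordWithin? inner outer

isBox-irrelevant : ∀ {d} {B : Box d} → Irrelevant (IsBox B)
isBox-irrelevant = VAll.irrelevant ℕP.≤-irrelevant

isBox? : ∀ {d} (B : Box d) → Dec (IsBox B)
isBox? = VAll.all? (λ c → 1 ℕ.≤? proj₂ c)

anchored-irrelevant : ∀ {d} {B : Box d} → Irrelevant (Anchored B)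
anchored-irrelevant = VAll.irrelevant (UIP.Decidable⇒UIP.≡-irrelevant ℤP._≟_)

anchored? : ∀ {d} (B : Box d) → Dec (Anchored B)
anchored? = VAll.all? (λ c → proj₁ c ℤP.≟ + 0)

kindCond-irrelevant : ∀ t {d} {bs : List (Box d)} → Irrelevant (KindCond t bs)
kindCond-irrelevant e = LAll.irrelevant anchored-irrelevant
kindCond-irrelevant p tt tt = refl

kindCond? : ∀ t {d} (bs : List (Box d)) → Dec (KindCond t bs)
kindCond? e = LAll.all? anchored?
kindCond? p _ = yes tt

Plateaus : ℕ → Set
Plateaus d = Box d × List (Box d)

module Structures (t : Kind) (v : ℕ) where

  IsStructure : ∀ d → Plateaus d → Set
  IsStructure d (b , u) = LAll.All IsBox (b ∷ u) × Anchored b × Linked Contains (b ∷ u)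
                        × KindCond t (b ∷ u) × sum (List.map cells (b ∷ u)) ≡ v

  isStructure-irrelevant : ∀ d r → Irrelevant (IsStructure d r)
  isStructure-irrelevant d (b , u) =
    ×-irrelevant (LAll.irrelevant isBox-irrelevant) (×-irrelevant anchored-irrelevant
      (×-irrelevant (Linked.irrelevant contains-irrelevant)
        (×-irrelevant (kindCond-irrelevant t) ℕP.≡-irrelevant)))

  isStructure? : ∀ d r → Dec (IsStructure d r)
  isStructure? d (b , u) = LAll.all? isBox? (b ∷ u) ×-dec anchored? b ×-dec Linked.linked? contains? (b ∷ u)
                           ×-dec kindCond? t (b ∷ u) ×-dec (sum (List.map cells (b ∷ u)) ℕP.≟ v)

  structure-↔ : ∀ d → Structure t d v ↔ Σ (Plateaus d) (IsStructure d)
  structure-↔ d = mk↔ₛ′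
    (λ s → let open Structure s in (base , upper) , boxes , anchored , nested , kindCond , volume)
    (λ { ((b , u) , bx , an , ne , kc , vol) → mkStructure b u bx an ne kc vol }) (λ _ → refl) (λ _ → refl)

cells-positive : ∀ {d} (B : Box d) → IsBox B → 1 ≤ cells B
cells-positive [] [] = s≤s z≤n
cells-positive (c ∷ B) (h ∷ hs) = ℕP.*-mono-≤ h (cells-positive B hs)

side≤cells : ∀ {d} (B : Box d) → IsBox B → VAll.All (λ c → proj₂ c ≤ cells B) B
side≤cells [] [] = []
side≤cells (c ∷ B) (h ∷ hs) =
  ℕP.m≤m*n (proj₂ c) (cells B) {{ℕ.>-nonZero (cells-positive B hs)}}
  ∷ VAll.map (λ le → ℕP.≤-trans le (ℕP.m≤n*m (cells B) (proj₂ c) {{ℕ.>-nonZero h}})) (side≤cells B hs)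

contains-refl : ∀ {d} (B : Box d) → Contains B B
contains-refl B = PW.refl (ℤP.≤-refl , ℤP.≤-refl)

contains-trans : ∀ {d} {outer middle inner : Box d} → Contains outer middle → Contains middle inner →
                 Contains outer inner
contains-trans outer⊇middle middle⊇inner =
  PW.trans (λ (l₁ , r₁) (l₂ , r₂) → ℤP.≤-trans l₂ l₁ , ℤP.≤-trans r₁ r₂) middle⊇inner outer⊇middle

base-contains-all : ∀ {d} (b : Box d) u → Linked Contains (b ∷ u) → LAll.All (Contains b) u
base-contains-all b [] _ = []
base-contains-all b (b' ∷ u) (b⊇b' ∷ nested) =
  b⊇b' ∷ LAll.map (contains-trans b⊇b') (base-contains-all b' u nested)

length≤volume : ∀ {d} (u : List (Box d)) → LAll.All IsBox u → length u ≤ sum (List.map cells u)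
length≤volume [] [] = z≤n
length≤volume (b ∷ u) (h ∷ hs) = ℕP.+-mono-≤ (cells-positive b h) (length≤volume u hs)

-- A structure of volume v is determined by finitely many numbers in {0, …, v}: all plateaus lie in
-- the base, whose corner is 0 and whose sides are at most v, and there are fewer than v higher
-- plateaus.
module Encoding (t : Kind) (v : ℕ) where
  open Structures t v

  Digit : Set
  Digit = Fin (suc v)

  digit : ℕ → Digit
  digit n = n mod suc v

  digit-≤ : ∀ {n} → n ≤ v → F.toℕ (digit n) ≡ n
  digit-≤ le = trans (FP.toℕ-fromℕ< _) (m≤n⇒m%n≡m le)

  Bounded : ℤ × ℕ → Set
  Bounded c = (Σ ℕ λ n → proj₁ c ≡ + n × n ≤ v) × proj₂ c ≤ v

  encodeCoord : ℤ × ℕ → Digit × Digit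
  encodeCoord (z , l) = digit ℤ.∣ z ∣ , digit l

  decodeCoord : Digit × Digit → ℤ × ℕ
  decodeCoord (i , j) = + F.toℕ i , F.toℕ j

  decode-encodeCoord : ∀ c → Bounded c → decodeCoord (encodeCoord c) ≡ c
  decode-encodeCoord (.(+ n) , l) ((n , refl , n≤v) , l≤v) = cong₂ _,_ (cong +_ (digit-≤ n≤v)) (digit-≤ l≤v)

  decode-encodeBox : ∀ {d} (B : Box d) → VAll.All Bounded B → Vec.map decodeCoord (Vec.map encodeCoord B) ≡ B
  decode-encodeBox [] [] = refl
  decode-encodeBox (c ∷ B) (bc ∷ bB) = cong₂ _∷_ (decode-encodeCoord c bc) (decode-encodeBox B bB)

  encodeList : ∀ {d} n → List (Box d) → Vec (Maybe (Vec (Digit × Digit) d)) n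
  encodeList zero _ = []
  encodeList (suc n) [] = nothing ∷ encodeList n []
  encodeList (suc n) (B ∷ Bs) = just (Vec.map encodeCoord B) ∷ encodeList n Bs

  decodeList : ∀ {d n} → Vec (Maybe (Vec (Digit × Digit) d)) n → List (Box d)
  decodeList [] = []
  decodeList (nothing ∷ _) = []
  decodeList (just B ∷ Bs) = Vec.map decodeCoord B ∷ decodeList Bs

  decode-encodeList : ∀ {d} n (Bs : List (Box d)) → length Bs ≤ n → LAll.All (VAll.All Bounded) Bs →
                      decodeList (encodeList n Bs) ≡ Bs
  decode-encodeList zero [] _ _ = refl
  decode-encodeList (suc n) [] _ _ = refl
  decode-encodeList (suc n) (B ∷ Bs) (s≤s le) (bB ∷ bBs) =
    cong₂ _∷_ (decode-encodeBox B bB) (decode-encodeList n Bs le bBs)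

  Code : ℕ → Set
  Code d = Vec (Digit × Digit) d × Vec (Maybe (Vec (Digit × Digit) d)) v

  finite-Code : ∀ d → Finite (Code d)
  finite-Code d = finite-× (finite-Vec finite-coord d) (finite-Vec (finite-Maybe (finite-Vec finite-coord d)) v)
    where
    finite-coord : Finite (Digit × Digit)
    finite-coord = finite-× (suc v , ↔-refl) (suc v , ↔-refl)

  code-≟ : ∀ d → DecidableEquality (Code d)
  code-≟ d = ×P.≡-dec (VP.≡-dec coord-≟) (VP.≡-dec (MP.≡-dec (VP.≡-dec coord-≟)))
    where
    coord-≟ : DecidableEquality (Digit × Digit)
    coord-≟ = ×P.≡-dec FP._≟_ FP._≟_

  encode : ∀ {d} → Plateaus d → Code d
  encode (b , u) = Vec.map encodeCoord b , encodeList v u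

  decode : ∀ {d} → Code d → Plateaus d
  decode (b , u) = Vec.map decodeCoord b , decodeList u

  within-bounded : ∀ c' c → CoordWithin c' c → proj₁ c ≡ + 0 → proj₂ c ≤ v → Bounded c'
  within-bounded (+ n , l') (.(+ 0) , l) (ℤ.+≤+ z≤n , ℤ.+≤+ n+l'≤l) refl l≤v =
    (n , refl , ℕP.≤-trans (ℕP.m≤m+n n l') n+l'≤v) , ℕP.≤-trans (ℕP.m≤n+m l' n) n+l'≤v
    where
    n+l'≤v : n + l' ≤ v
    n+l'≤v = ℕP.≤-trans n+l'≤l l≤v
  within-bounded (-[1+ n ] , l') (.(+ 0) , l) (() , _) refl l≤v

  contained-bounded : ∀ {d} {b B : Box d} → Contains b B → Anchored b → VAll.All (λ c → proj₂ c ≤ v) b →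
                      VAll.All Bounded B
  contained-bounded [] [] [] = []
  contained-bounded {b = c ∷ _} {c' ∷ _} (w ∷ ws) (a ∷ as) (l ∷ ls) =
    within-bounded c' c w a l ∷ contained-bounded ws as ls

  decode-encode : ∀ d r → IsStructure d r → decode (encode r) ≡ r
  decode-encode d (b , u) (bx ∷ bxs , an , nested , _ , vol) =
    cong₂ _,_ (decode-encodeBox b (contained-bounded (contains-refl b) an sides≤v))
              (decode-encodeList v u length≤v
                (LAll.map (λ b⊇B → contained-bounded b⊇B an sides≤v) (base-contains-all b u nested)))
    where
    vol-split : cells b + sum (List.map cells u) ≤ v
    vol-split = ℕP.≤-reflexive vol
    sides≤v : VAll.All (λ c → proj₂ c ≤ v) b
    sides≤v = VAll.map (λ le → ℕP.≤-trans le (ℕP.≤-trans (ℕP.m≤m+n (cells b) _) vol-split)) (side≤cells b bx)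
    length≤v : length u ≤ v
    length≤v = ℕP.≤-trans (ℕP.≤-trans (ℕP.n≤1+n _) (ℕP.+-mono-≤ (cells-positive b bx) (length≤volume u bxs)))
                          vol-split

  finite-structures : ∀ d (Q : Plateaus d → Set) → (∀ r → Dec (Q r)) → (∀ r → Irrelevant (Q r)) →
                      Finite (Σ (Plateaus d) (λ r → IsStructure d r × Q r))
  finite-structures d Q decQ irrQ =
    finite-encodable (λ r → IsStructure d r × Q r) (finite-Code d) (code-≟ d) encode decode
      (λ r s → decode-encode d r (proj₁ s)) (λ r → isStructure? d r ×-dec decQ r)
      (λ r → ×-irrelevant (isStructure-irrelevant d r) (irrQ r))

module _ {X : Set} where
  front : ∀ k {n} → Vec X (k + n) → Vec X k
  front zero _ = []
  front (suc k) (x ∷ xs) = x ∷ front k xs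

  coordAt : ∀ k {n} → Vec X (k + suc n) → X
  coordAt zero (x ∷ xs) = x
  coordAt (suc k) (x ∷ xs) = coordAt k xs

  deleteAt : ∀ k {n} → Vec X (k + suc n) → Vec X (k + n)
  deleteAt zero (x ∷ xs) = xs
  deleteAt (suc k) (x ∷ xs) = x ∷ deleteAt k xs

  insertAt : ∀ k {n} → X → Vec X (k + n) → Vec X (k + suc n)
  insertAt zero a xs = a ∷ xs
  insertAt (suc k) a (x ∷ xs) = x ∷ insertAt k a xs

  insert-delete : ∀ k {n} (xs : Vec X (k + suc n)) → insertAt k (coordAt k xs) (deleteAt k xs) ≡ xs
  insert-delete zero (x ∷ xs) = refl
  insert-delete (suc k) (x ∷ xs) = cong (x ∷_) (insert-delete k xs)

  delete-insert : ∀ k {n} a (xs : Vec X (k + n)) → deleteAt k (insertAt k a xs) ≡ xs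
  delete-insert zero a xs = refl
  delete-insert (suc k) a (x ∷ xs) = cong (x ∷_) (delete-insert k a xs)

  coordAt-insert : ∀ k {n} a (xs : Vec X (k + n)) → coordAt k (insertAt k a xs) ≡ a
  coordAt-insert zero a xs = refl
  coordAt-insert (suc k) a (x ∷ xs) = coordAt-insert k a xs

  front-delete : ∀ k {n} (xs : Vec X (k + suc n)) → front k (deleteAt k xs) ≡ front k xs
  front-delete zero xs = refl
  front-delete (suc k) (x ∷ xs) = cong (x ∷_) (front-delete k xs)

  front-insert : ∀ k {n} a (xs : Vec X (k + n)) → front k (insertAt k a xs) ≡ front k xs
  front-insert zero a xs = refl
  front-insert (suc k) a (x ∷ xs) = cong (x ∷_) (front-insert k a xs)

  module _ {P : X → Set} where
    all-coordAt : ∀ k {n} {xs : Vec X (k + suc n)} → VAll.All P xs → P (coordAt k xs)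
    all-coordAt zero (px ∷ _) = px
    all-coordAt (suc k) {xs = _ ∷ _} (_ ∷ pxs) = all-coordAt k pxs

    all-deleteAt : ∀ k {n} {xs : Vec X (k + suc n)} → VAll.All P xs → VAll.All P (deleteAt k xs)
    all-deleteAt zero (_ ∷ pxs) = pxs
    all-deleteAt (suc k) {xs = _ ∷ _} (px ∷ pxs) = px ∷ all-deleteAt k pxs

    all-insertAt : ∀ k {n} {a} {xs : Vec X (k + n)} → P a → VAll.All P xs → VAll.All P (insertAt k a xs)
    all-insertAt zero pa pxs = pa ∷ pxs
    all-insertAt (suc k) {xs = _ ∷ _} pa (px ∷ pxs) = px ∷ all-insertAt k pa pxs

  module _ {R : X → X → Set} where
    pointwise-coordAt : ∀ k {n} {xs ys : Vec X (k + suc n)} → Pointwise R xs ys → R (coordAt k xs) (coordAt k ys)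
    pointwise-coordAt zero (r ∷ _) = r
    pointwise-coordAt (suc k) {xs = _ ∷ _} {_ ∷ _} (_ ∷ rs) = pointwise-coordAt k rs

    pointwise-deleteAt : ∀ k {n} {xs ys : Vec X (k + suc n)} → Pointwise R xs ys →
                         Pointwise R (deleteAt k xs) (deleteAt k ys)
    pointwise-deleteAt zero (_ ∷ rs) = rs
    pointwise-deleteAt (suc k) {xs = _ ∷ _} {_ ∷ _} (r ∷ rs) = r ∷ pointwise-deleteAt k rs

    pointwise-insertAt : ∀ k {n} {a b} {xs ys : Vec X (k + n)} → R a b → Pointwise R xs ys →
                         Pointwise R (insertAt k a xs) (insertAt k b ys)
    pointwise-insertAt zero r rs = r ∷ rs
    pointwise-insertAt (suc k) {xs = _ ∷ _} {_ ∷ _} r (r' ∷ rs) = r' ∷ pointwise-insertAt k r rs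

cells-coordAt : ∀ k {n} (B : Box (k + suc n)) → cells B ≡ proj₂ (coordAt k B) * cells (deleteAt k B)
cells-coordAt zero (c ∷ B) = refl
cells-coordAt (suc k) (c ∷ B) = begin
  proj₂ c * cells B                                    ≡⟨ cong (proj₂ c *_) (cells-coordAt k B) ⟩
  proj₂ c * (proj₂ (coordAt k B) * cells (deleteAt k B)) ≡⟨ x∙yz≈y∙xz (proj₂ c) (proj₂ (coordAt k B)) (cells (deleteAt k B)) ⟩
  proj₂ (coordAt k B) * (proj₂ c * cells (deleteAt k B)) ∎
  where open ≡-Reasoning

cells-insertAt : ∀ k {n} c (B : Box (k + n)) → cells (insertAt k c B) ≡ proj₂ c * cells B
cells-insertAt k c B = trans (cells-coordAt k (insertAt k c B))
  (cong₂ (λ c' B' → proj₂ c' * cells B') (coordAt-insert k c B) (delete-insert k c B))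

module _ (t : Kind) (v : ℕ) where
  open Structures t v

  map-structure : ∀ {m m'} (f : Box m → Box m') →
    (∀ {B} → IsBox B → IsBox (f B)) → (∀ {B} → Anchored B → Anchored (f B)) →
    (∀ {B B'} → Contains B B' → Contains (f B) (f B')) →
    ∀ b u → LAll.All (λ B → cells (f B) ≡ cells B) (b ∷ u) →
    IsStructure m (b , u) → IsStructure m' (f b , List.map f u)
  map-structure f f-isBox f-anchored f-contains b u same-cells (bx , an , nested , kc , vol) =
    AllP.map⁺ (LAll.map f-isBox bx) , f-anchored an , LinkedP.map⁺ (Linked.map f-contains nested) ,
    kindCond t kc , volume
    where
    kindCond : ∀ t' → KindCond t' (b ∷ u) → KindCond t' (f b ∷ List.map f u)
    kindCond e anchoredAll = AllP.map⁺ (LAll.map f-anchored anchoredAll)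
    kindCond p _ = tt
    volume : sum (List.map cells (f b ∷ List.map f u)) ≡ v
    volume = begin
      sum (List.map cells (List.map f (b ∷ u))) ≡⟨ cong sum (ListP.map-∘ (b ∷ u)) ⟨
      sum (List.map (cells ∘ f) (b ∷ u))        ≡⟨ cong sum (ListP.map-cong-local same-cells) ⟩
      sum (List.map cells (b ∷ u))              ≡⟨ vol ⟩
      v                                         ∎
      where open ≡-Reasoning

map-inverse-local : ∀ {A B : Set} {f : A → B} {g : B → A} {xs} → LAll.All (λ x → g (f x) ≡ x) xs →
                    List.map g (List.map f xs) ≡ xs
map-inverse-local {xs = xs} gf = trans (sym (ListP.map-∘ xs)) (ListP.map-id-local gf)

module Splitting (t : Kind) (v : ℕ) where
  open Structures t v

  Thick : ∀ k {n} → Box (k + n) → Set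
  Thick k B = VAll.All (λ c → 2 ≤ proj₂ c) (front k B)

  thick-irrelevant : ∀ k {n} {B : Box (k + n)} → Irrelevant (Thick k B)
  thick-irrelevant k = VAll.irrelevant ℕP.≤-irrelevant

  thick? : ∀ k {n} (B : Box (k + n)) → Dec (Thick k B)
  thick? k B = VAll.all? (λ c → 2 ℕ.≤? proj₂ c) (front k B)

  IsThickStructure : ∀ k n → Plateaus (k + n) → Set
  IsThickStructure k n r = IsStructure (k + n) r × Thick k (proj₁ r)

  isThickStructure-irrelevant : ∀ k n r → Irrelevant (IsThickStructure k n r)
  isThickStructure-irrelevant k n r = ×-irrelevant (isStructure-irrelevant (k + n) r) (thick-irrelevant k)

  ThickStructure : ℕ → ℕ → Set
  ThickStructure k n = Σ (Plateaus (k + n)) (IsThickStructure k n)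

  ThinAt ThickAt : ∀ k n → Plateaus (k + suc n) → Set
  ThinAt k n (b , _) = proj₂ (coordAt k b) ≡ 1
  ThickAt k n (b , _) = 2 ≤ proj₂ (coordAt k b)

  unit : ℤ × ℕ
  unit = + 0 , 1

  within-unit : ∀ c → CoordWithin c unit → 1 ≤ proj₂ c → c ≡ unit
  within-unit (+ zero , l) (_ , ℤ.+≤+ l≤1) 1≤l = cong (+ 0 ,_) (ℕP.≤-antisym l≤1 1≤l)
  within-unit (+ suc n , l) (_ , ℤ.+≤+ (s≤s n+l≤0)) 1≤l with ℕP.≤-trans 1≤l (ℕP.≤-trans (ℕP.m≤n+m l n) n+l≤0)
  ... | ()
  within-unit (-[1+ n ] , l) (() , _) 1≤l

  thin-everywhere : ∀ k n b u → IsStructure (k + suc n) (b , u) → ThinAt k n (b , u) →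
                    LAll.All (λ B → coordAt k B ≡ unit) (b ∷ u)
  thin-everywhere k n b u (bx ∷ bxs , an , nested , _) thin = b-unit ∷ go u bxs (base-contains-all b u nested)
    where
    b-unit : coordAt k b ≡ unit
    b-unit = ×P.×-≡,≡→≡ (all-coordAt k an , thin)
    go : ∀ w → LAll.All IsBox w → LAll.All (Contains b) w → LAll.All (λ B → coordAt k B ≡ unit) w
    go [] [] [] = []
    go (B ∷ w) (Bx ∷ Bxs) (b⊇B ∷ b⊇w) =
      within-unit (coordAt k B) (subst (CoordWithin (coordAt k B)) b-unit (pointwise-coordAt k b⊇B))
                  (all-coordAt k Bx)
      ∷ go w Bxs b⊇w

  delete-thin : ∀ k n → Σ (Plateaus (k + suc n)) (λ r → IsThickStructure k (suc n) r × ThinAt k n r)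
                        ↔ ThickStructure k n
  delete-thin k n = subset-↔
    (λ r → ×-irrelevant (isThickStructure-irrelevant k (suc n) r) ℕP.≡-irrelevant)
    (isThickStructure-irrelevant k n) delete insert delete-ok insert-ok insert-delete-ok delete-insert-ok
    where
    delete : Plateaus (k + suc n) → Plateaus (k + n)
    delete (b , u) = deleteAt k b , List.map (deleteAt k) u
    insert : Plateaus (k + n) → Plateaus (k + suc n)
    insert (b , u) = insertAt k unit b , List.map (insertAt k unit) u
    cells-delete : ∀ B → coordAt k B ≡ unit → cells (deleteAt k B) ≡ cells B
    cells-delete B B-unit = sym (begin
      cells B                                        ≡⟨ cells-coordAt k B ⟩
      proj₂ (coordAt k B) * cells (deleteAt k B)     ≡⟨ cong (λ c → proj₂ c * cells (deleteAt k B)) B-unit ⟩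
      1 * cells (deleteAt k B)                       ≡⟨ ℕP.*-identityˡ _ ⟩
      cells (deleteAt k B)                           ∎)
      where open ≡-Reasoning
    reinsert : ∀ B → coordAt k B ≡ unit → insertAt k unit (deleteAt k B) ≡ B
    reinsert B B-unit = trans (cong (λ c → insertAt k c (deleteAt k B)) (sym B-unit)) (insert-delete k B)
    delete-ok : ∀ r → IsThickStructure k (suc n) r × ThinAt k n r → IsThickStructure k n (delete r)
    delete-ok (b , u) ((s , thick) , thin) =
      map-structure t v (deleteAt k) (all-deleteAt k) (all-deleteAt k) (pointwise-deleteAt k) b u
        (LAll.map (λ {B} → cells-delete B) (thin-everywhere k n b u s thin)) s
      , subst (VAll.All _) (sym (front-delete k b)) thick
    insert-ok : ∀ r → IsThickStructure k n r → IsThickStructure k (suc n) (insert r) × ThinAt k n (insert r)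
    insert-ok (b , u) (s , thick) =
      (map-structure t v (insertAt k unit) (all-insertAt k (s≤s z≤n)) (all-insertAt k refl)
         (pointwise-insertAt k (ℤP.≤-refl , ℤP.≤-refl)) b u
         (LAll.universal (λ B → trans (cells-insertAt k unit B) (ℕP.*-identityˡ _)) (b ∷ u)) s
      , subst (VAll.All _) (sym (front-insert k unit b)) thick)
      , cong proj₂ (coordAt-insert k unit b)
    insert-delete-ok : ∀ r → IsThickStructure k (suc n) r × ThinAt k n r → insert (delete r) ≡ r
    insert-delete-ok (b , u) ((s , _) , thin) with thin-everywhere k n b u s thin
    ... | b-unit ∷ u-unit = cong₂ _,_ (reinsert b b-unit) (map-inverse-local (LAll.map (λ {B} → reinsert B) u-unit))
    delete-insert-ok : ∀ r → IsThickStructure k n r → delete (insert r) ≡ r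
    delete-insert-ok (b , u) _ =
      cong₂ _,_ (delete-insert k unit b) (map-inverse-local (LAll.universal (delete-insert k unit) u))

  rotate-thick : ∀ k n → Σ (Plateaus (k + suc n)) (λ r → IsThickStructure k (suc n) r × ThickAt k n r)
                         ↔ ThickStructure (suc k) n
  rotate-thick k n = subset-↔
    (λ r → ×-irrelevant (isThickStructure-irrelevant k (suc n) r) ℕP.≤-irrelevant)
    (isThickStructure-irrelevant (suc k) n) rotate unrotate rotate-ok unrotate-ok unrotate-rotate-ok
    rotate-unrotate-ok
    where
    toFront : Box (k + suc n) → Box (suc k + n)
    toFront B = coordAt k B ∷ deleteAt k B
    fromFront : Box (suc k + n) → Box (k + suc n)
    fromFront (c ∷ B) = insertAt k c B
    toFront-fromFront : ∀ B → toFront (fromFront B) ≡ B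
    toFront-fromFront (c ∷ B) = cong₂ _∷_ (coordAt-insert k c B) (delete-insert k c B)
    cells-fromFront : ∀ B → cells (fromFront B) ≡ cells B
    cells-fromFront (c ∷ B) = cells-insertAt k c B
    rotate : Plateaus (k + suc n) → Plateaus (suc k + n)
    rotate (b , u) = toFront b , List.map toFront u
    unrotate : Plateaus (suc k + n) → Plateaus (k + suc n)
    unrotate (b , u) = fromFront b , List.map fromFront u
    rotate-ok : ∀ r → IsThickStructure k (suc n) r × ThickAt k n r → IsThickStructure (suc k) n (rotate r)
    rotate-ok (b , u) ((s , thick) , thickAt) =
      map-structure t v toFront (λ bx → all-coordAt k bx ∷ all-deleteAt k bx)
        (λ an → all-coordAt k an ∷ all-deleteAt k an) (λ w → pointwise-coordAt k w ∷ pointwise-deleteAt k w)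
        b u (LAll.universal (λ B → sym (cells-coordAt k B)) (b ∷ u)) s
      , thickAt ∷ subst (VAll.All _) (sym (front-delete k b)) thick
    unrotate-ok : ∀ r → IsThickStructure (suc k) n r → IsThickStructure k (suc n) (unrotate r) × ThickAt k n (unrotate r)
    unrotate-ok (c ∷ b , u) (s , thickAt ∷ thick) =
      (map-structure t v fromFront (λ { (h ∷ hs) → all-insertAt k h hs }) (λ { (h ∷ hs) → all-insertAt k h hs })
         (λ { (w ∷ ws) → pointwise-insertAt k w ws }) (c ∷ b) u
         (LAll.universal cells-fromFront ((c ∷ b) ∷ u)) s
      , subst (VAll.All _) (sym (front-insert k c b)) thick)
      , subst (λ c' → 2 ≤ proj₂ c') (sym (coordAt-insert k c b)) thickAt
    unrotate-rotate-ok : ∀ r → IsThickStructure k (suc n) r × ThickAt k n r → unrotate (rotate r) ≡ r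
    unrotate-rotate-ok (b , u) _ = cong₂ _,_ (insert-delete k b) (map-inverse-local (LAll.universal (insert-delete k) u))
    rotate-unrotate-ok : ∀ r → IsThickStructure (suc k) n r → rotate (unrotate r) ≡ r
    rotate-unrotate-ok (b , u) _ = cong₂ _,_ (toFront-fromFront b) (map-inverse-local (LAll.universal toFront-fromFront u))

  -- The fundamental recursion: direction k of the base is either thin or thick.
  split : ∀ k n → ThickStructure k (suc n) ↔ (ThickStructure k n ⊎ ThickStructure (suc k) n)
  split k n = ↔-trans
    (Σ-split (isThickStructure-irrelevant k (suc n)) (λ _ → ℕP.≡-irrelevant) (λ _ → ℕP.≤-irrelevant)
      thin-or-thick (λ _ thin thick → ℕP.<-irrefl (sym thin) thick))
    (delete-thin k n ⊎-↔ rotate-thick k n)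
    where
    thin-or-thick : ∀ r → IsThickStructure k (suc n) r → ThinAt k n r ⊎ ThickAt k n r
    thin-or-thick (b , _) ((bx ∷ _ , _) , _) with proj₂ (coordAt k b) | all-coordAt k bx
    ... | suc zero    | _ = inj₁ refl
    ... | suc (suc l) | _ = inj₂ (s≤s (s≤s z≤n))

  structure-↔-thick₀ : ∀ n → Structure t n v ↔ ThickStructure 0 n
  structure-↔-thick₀ n = ↔-trans (structure-↔ n)
    (subset-↔ (isStructure-irrelevant n) (isThickStructure-irrelevant 0 n) (λ r → r) (λ r → r)
      (λ _ s → s , []) (λ _ → proj₁) (λ _ _ → refl) (λ _ _ → refl))

choose : ℕ → ℕ → ℕ
choose zero zero = 1
choose zero (suc j) = 0
choose (suc d) zero = 1
choose (suc d) (suc j) = choose d j + choose d (suc j)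

choose-zero : ∀ d → choose d 0 ≡ 1
choose-zero zero = refl
choose-zero (suc d) = refl

sumTo : ℕ → (ℕ → ℕ) → ℕ
sumTo zero f = 0
sumTo (suc n) f = f 0 + sumTo n (λ j → f (suc j))

sumTo-cong : ∀ n {f g : ℕ → ℕ} → (∀ j → f j ≡ g j) → sumTo n f ≡ sumTo n g
sumTo-cong zero _ = refl
sumTo-cong (suc n) f≗g = cong₂ _+_ (f≗g 0) (sumTo-cong n (λ j → f≗g (suc j)))

sumTo-+ : ∀ n (f g : ℕ → ℕ) → sumTo n (λ j → f j + g j) ≡ sumTo n f + sumTo n g
sumTo-+ zero f g = refl
sumTo-+ (suc n) f g = trans (cong (λ s → f 0 + g 0 + s) (sumTo-+ n _ _)) swap-middle
  where
  open NS using (_:+_; _:=_)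
  swap-middle : (f 0 + g 0) + (sumTo n (λ j → f (suc j)) + sumTo n (λ j → g (suc j)))
              ≡ (f 0 + sumTo n (λ j → f (suc j))) + (g 0 + sumTo n (λ j → g (suc j)))
  swap-middle = NS.solve 4 (λ a b c d → (a :+ b) :+ (c :+ d) := (a :+ c) :+ (b :+ d)) refl
                  (f 0) (g 0) (sumTo n (λ j → f (suc j))) (sumTo n (λ j → g (suc j)))

sumTo-last : ∀ n (f : ℕ → ℕ) → sumTo (suc n) f ≡ sumTo n f + f n
sumTo-last zero f = ℕP.+-comm (f 0) 0
sumTo-last (suc n) f = trans (cong (λ s → f 0 + s) (sumTo-last n (λ j → f (suc j)))) (sym (ℕP.+-assoc (f 0) _ _))

-- The binomial transform of a sequence a supported on {0, …, D}:
--   binomialSum d k = Σ_{j ≤ D} C(d, j) · a (k + j),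
-- which obeys the same recursion in d as the counts of thick structures.
module BinomialSum (a : ℕ → ℕ) (D : ℕ) (vanish : ∀ k → D < k → a k ≡ 0) where

  binomialSum : ℕ → ℕ → ℕ
  binomialSum d k = sumTo (suc D) (λ j → choose d j * a (k + j))

  binomialSum-zero : ∀ k → binomialSum 0 k ≡ a k
  binomialSum-zero k = begin
    a (k + 0) + 0 + sumTo D (λ _ → 0) ≡⟨ cong₂ _+_ (trans (ℕP.+-identityʳ _) (cong a (ℕP.+-identityʳ k))) (sum-zeros D) ⟩
    a k + 0                           ≡⟨ ℕP.+-identityʳ (a k) ⟩
    a k                               ∎
    where
    open ≡-Reasoning
    sum-zeros : ∀ n → sumTo n (λ _ → 0) ≡ 0
    sum-zeros zero = refl
    sum-zeros (suc n) = sum-zeros n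

  binomialSum-suc : ∀ d k → binomialSum (suc d) k ≡ binomialSum d k + binomialSum d (suc k)
  binomialSum-suc d k = begin
      binomialSum (suc d) k
    ≡⟨ cong (_+ sumTo D (λ j → choose (suc d) (suc j) * a (k + suc j))) (ℕP.+-identityʳ (a (k + 0))) ⟩
      a (k + 0) + sumTo D (λ j → (choose d j + choose d (suc j)) * a (k + suc j))
    ≡⟨ cong (λ s → a (k + 0) + s) (trans (sumTo-cong D (λ j → ℕP.*-distribʳ-+ (a (k + suc j)) (choose d j) _))
                                  (sumTo-+ D _ _)) ⟩
      a (k + 0) + (shifted + rest)
    ≡⟨ NS.solve 3 (λ x y z → x :+ (y :+ z) := (x :+ z) :+ y) refl (a (k + 0)) shifted rest ⟩
      (a (k + 0) + rest) + shifted
    ≡⟨ cong (λ s → a (k + 0) + rest + s) shifted≡next ⟩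
      (a (k + 0) + rest) + binomialSum d (suc k)
    ≡⟨ cong (λ c → c + rest + binomialSum d (suc k)) (sym (trans (cong (_* a (k + 0)) (choose-zero d)) (ℕP.*-identityˡ _))) ⟩
      binomialSum d k + binomialSum d (suc k)
    ∎
    where
    open ≡-Reasoning
    open NS using (_:+_; _:=_)
    shifted rest : ℕ
    shifted = sumTo D (λ j → choose d j * a (k + suc j))
    rest = sumTo D (λ j → choose d (suc j) * a (k + suc j))
    -- the top term C(d, D) · a (k + 1 + D) of binomialSum d (k + 1) vanishes
    shifted≡next : shifted ≡ binomialSum d (suc k)
    shifted≡next = sym (begin
        binomialSum d (suc k)
      ≡⟨ sumTo-last D (λ j → choose d j * a (suc k + j)) ⟩
        sumTo D (λ j → choose d j * a (suc k + j)) + choose d D * a (suc k + D)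
      ≡⟨ cong₂ _+_ (sumTo-cong D (λ j → cong (λ m → choose d j * a m) (sym (ℕP.+-suc k j))))
                   (cong (choose d D *_) (vanish (suc k + D) (s≤s (ℕP.m≤n+m D k)))) ⟩
        shifted + choose d D * 0
      ≡⟨ trans (cong (λ s → shifted + s) (ℕP.*-zeroʳ (choose d D))) (ℕP.+-identityʳ shifted) ⟩
        shifted
      ∎)

≤⌊log₂⌋ : ∀ {j v} → 2 ^ j ≤ v → j ≤ ⌊log₂ v ⌋
≤⌊log₂⌋ {j} 2^j≤v = subst (_≤ _) (⌊log₂[2^n]⌋≡n j) (⌊log₂⌋-mono-≤ 2^j≤v)

2^⌊log₂⌋≤ : ∀ v → 1 ≤ v → 2 ^ ⌊log₂ v ⌋ ≤ v
2^⌊log₂⌋≤ = <-rec (λ v → 1 ≤ v → 2 ^ ⌊log₂ v ⌋ ≤ v) step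
  where
  step : ∀ v → (∀ {m} → m < v → 1 ≤ m → 2 ^ ⌊log₂ m ⌋ ≤ m) → 1 ≤ v → 2 ^ ⌊log₂ v ⌋ ≤ v
  step (suc zero) _ _ = s≤s z≤n
  step v@(suc (suc n)) ih _ = begin
    2 ^ ⌊log₂ v ⌋            ≡⟨ cong (2 ^_) log-v ⟩
    2 * 2 ^ ⌊log₂ half ⌋     ≤⟨ ℕP.*-monoʳ-≤ 2 (ih (ℕP.⌊n/2⌋<n (suc n)) (s≤s z≤n)) ⟩
    half + (half + 0)        ≤⟨ ℕP.+-monoʳ-≤ half (ℕP.≤-trans (ℕP.≤-reflexive (ℕP.+-identityʳ half)) (ℕP.⌊n/2⌋≤⌈n/2⌉ v)) ⟩
    half + ℕ.⌈ v /2⌉         ≡⟨ ℕP.⌊n/2⌋+⌈n/2⌉≡n v ⟩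
    v                        ∎
    where
    open ℕP.≤-Reasoning
    half : ℕ
    half = ⌊ v /2⌋
    log-v : ⌊log₂ v ⌋ ≡ suc ⌊log₂ half ⌋
    log-v = trans (sym (ℕP.m+[n∸m]≡n (⌊log₂⌋-mono-≤ {2} {v} (s≤s (s≤s z≤n)))))
                  (cong suc (sym (⌊log₂⌊n/2⌋⌋≡⌊log₂n⌋∸1 v)))

linked-replicate : ∀ {A : Set} {R : A → A → Set} {x y} m → R x y → R y y → Linked R (x ∷ List.replicate m y)
linked-replicate zero _ _ = [-]
linked-replicate (suc m) Rxy Ryy = Rxy ∷ linked-replicate m Ryy Ryy

module Counting (t : Kind) (v : ℕ) (v≥1 : 1 ≤ v) where
  open Structures t v
  open Encoding t v
  open Splitting t v

  thick-cells : ∀ k {n} (B : Box (k + n)) → IsBox B → Thick k B → 2 ^ k ≤ cells B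
  thick-cells zero B bx _ = cells-positive B bx
  thick-cells (suc k) (c ∷ B) (_ ∷ bx) (2≤c ∷ thick) = ℕP.*-mono-≤ 2≤c (thick-cells k B bx thick)

  thick-volume : ∀ k n → ThickStructure k n → 2 ^ k ≤ v
  thick-volume k n ((b , u) , (bx ∷ _ , _ , _ , _ , vol) , thick) =
    ℕP.≤-trans (thick-cells k b bx thick) (ℕP.≤-trans (ℕP.m≤m+n (cells b) _) (ℕP.≤-reflexive vol))

  cube : ∀ k → ℕ → Box (k + 0)
  cube zero s = []
  cube (suc k) s = (+ 0 , s) ∷ cube k s

  cube-isBox : ∀ k {s} → 1 ≤ s → IsBox (cube k s)
  cube-isBox zero _ = []
  cube-isBox (suc k) 1≤s = 1≤s ∷ cube-isBox k 1≤s

  cube-anchored : ∀ k s → Anchored (cube k s)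
  cube-anchored zero s = []
  cube-anchored (suc k) s = refl ∷ cube-anchored k s

  cube-cells : ∀ k s → cells (cube k s) ≡ s ^ k
  cube-cells zero s = refl
  cube-cells (suc k) s = cong (s *_) (cube-cells k s)

  cube-contains : ∀ k {s s'} → s' ≤ s → Contains (cube k s) (cube k s')
  cube-contains zero _ = []
  cube-contains (suc k) s'≤s = (ℤP.≤-refl , ℤ.+≤+ s'≤s) ∷ cube-contains k s'≤s

  cube-thick : ∀ k → Thick k (cube k 2)
  cube-thick zero = []
  cube-thick (suc k) = ℕP.≤-refl ∷ cube-thick k

  units-volume : ∀ k m → sum (List.map cells (List.replicate m (cube k 1))) ≡ m
  units-volume k zero = refl
  units-volume k (suc m) = cong₂ _+_ (trans (cube-cells k 1) (ℕP.^-zeroˡ k)) (units-volume k m)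

  -- If 2 ^ k ≤ v, a fully thick structure of dimension k: the cube of side 2 topped by
  -- v − 2 ^ k unit cubes.
  tower : ∀ k → 2 ^ k ≤ v → ThickStructure k 0
  tower k 2^k≤v = (cube k 2 , List.replicate m (cube k 1)) ,
    (cube-isBox k (s≤s z≤n) ∷ AllP.replicate⁺ m (cube-isBox k ℕP.≤-refl) , cube-anchored k 2 ,
     linked-replicate m (cube-contains k (s≤s z≤n)) (cube-contains k ℕP.≤-refl) , kindCond t , volume) ,
    cube-thick k
    where
    m : ℕ
    m = v ∸ 2 ^ k
    kindCond : ∀ t' → KindCond t' (cube k 2 ∷ List.replicate m (cube k 1))
    kindCond e = cube-anchored k 2 ∷ AllP.replicate⁺ m (cube-anchored k 1)
    kindCond p = tt
    volume : sum (List.map cells (cube k 2 ∷ List.replicate m (cube k 1))) ≡ v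
    volume = trans (cong₂ _+_ (cube-cells k 2) (units-volume k m)) (ℕP.m+[n∸m]≡n 2^k≤v)

  -- (kept abstract: only the existence of the enumeration matters, never its computation)
  abstract
    finite-thick : ∀ k → Finite (ThickStructure k 0)
    finite-thick k = finite-structures (k + 0) (λ r → Thick k (proj₁ r)) (λ r → thick? k (proj₁ r)) (λ r → thick-irrelevant k)

  a : ℕ → ℕ
  a k = proj₁ (finite-thick k)

  a-vanishes : ∀ k → ⌊log₂ v ⌋ < k → a k ≡ 0
  a-vanishes k L<k = finite-empty (finite-thick k) (λ s → ℕP.<⇒≱ L<k (≤⌊log₂⌋ (thick-volume k 0 s)))

  a-top-positive : 1 ≤ a ⌊log₂ v ⌋
  a-top-positive = finite-inhabited (finite-thick ⌊log₂ v ⌋) (tower ⌊log₂ v ⌋ (2^⌊log₂⌋≤ v v≥1))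

  open BinomialSum a ⌊log₂ v ⌋ a-vanishes public

  count-thick : ∀ d k → Fin (binomialSum d k) ↔ ThickStructure k d
  count-thick zero k = subst (λ N → Fin N ↔ ThickStructure k 0) (sym (binomialSum-zero k)) (proj₂ (finite-thick k))
  count-thick (suc d) k = subst (λ N → Fin N ↔ ThickStructure k (suc d)) (sym (binomialSum-suc d k))
    (↔-trans FP.+↔⊎ (↔-trans (count-thick d k ⊎-↔ count-thick d (suc k)) (↔-sym (split k d))))

  count : ∀ d → Fin (binomialSum d 0) ↔ Structure t d v
  count d = ↔-trans (count-thick d 0) (↔-sym (structure-↔-thick₀ d))

ℕtoℚ-mkℚ : ∀ n → ℕtoℚ n ≡ mkℚ (+ n) 0 (Coprime.sym (1-coprimeTo n))
ℕtoℚ-mkℚ n = ℚP.normalize-coprime (Coprime.sym (1-coprimeTo n))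

toℚᵘ-ℕtoℚ : ∀ n → ℚ.toℚᵘ (ℕtoℚ n) ≡ U.mkℚᵘ (+ n) 0
toℚᵘ-ℕtoℚ n = cong ℚ.toℚᵘ (ℕtoℚ-mkℚ n)

ℕtoℚ-+ : ∀ m n → ℕtoℚ (m + n) ≡ ℕtoℚ m ℚ.+ ℕtoℚ n
ℕtoℚ-+ m n = ℚP.toℚᵘ-injective (begin
  ℚ.toℚᵘ (ℕtoℚ (m + n))                       ≡⟨ toℚᵘ-ℕtoℚ (m + n) ⟩
  U.mkℚᵘ (+ (m + n)) 0                        ≈⟨ U.*≡* eq ⟩
  U.mkℚᵘ (+ m) 0 U.+ U.mkℚᵘ (+ n) 0           ≡⟨ sym (cong₂ U._+_ (toℚᵘ-ℕtoℚ m) (toℚᵘ-ℕtoℚ n)) ⟩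
  ℚ.toℚᵘ (ℕtoℚ m) U.+ ℚ.toℚᵘ (ℕtoℚ n)         ≈⟨ UP.≃-sym (ℚP.toℚᵘ-homo-+ (ℕtoℚ m) (ℕtoℚ n)) ⟩
  ℚ.toℚᵘ (ℕtoℚ m ℚ.+ ℕtoℚ n)                  ∎)
  where
  open UP.≃-Reasoning
  open ZS using (_:+_; _:*_; _:=_; con)
  eq : + (m + n) ℤ.* + 1 ≡ (+ m ℤ.* + 1 ℤ.+ + n ℤ.* + 1) ℤ.* + 1
  eq = trans (cong (ℤ._* + 1) (ℤP.pos-+ m n))
         (ZS.solve 2 (λ x y → (x :+ y) :* con (+ 1) := (x :* con (+ 1) :+ y :* con (+ 1)) :* con (+ 1)) refl (+ m) (+ n))

ℕtoℚ-* : ∀ m n → ℕtoℚ (m * n) ≡ ℕtoℚ m ℚ.* ℕtoℚ n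
ℕtoℚ-* m n = ℚP.toℚᵘ-injective (begin
  ℚ.toℚᵘ (ℕtoℚ (m * n))                       ≡⟨ toℚᵘ-ℕtoℚ (m * n) ⟩
  U.mkℚᵘ (+ (m * n)) 0                        ≈⟨ U.*≡* (cong (ℤ._* + 1) (ℤP.pos-* m n)) ⟩
  U.mkℚᵘ (+ m) 0 U.* U.mkℚᵘ (+ n) 0           ≡⟨ sym (cong₂ U._*_ (toℚᵘ-ℕtoℚ m) (toℚᵘ-ℕtoℚ n)) ⟩
  ℚ.toℚᵘ (ℕtoℚ m) U.* ℚ.toℚᵘ (ℕtoℚ n)         ≈⟨ UP.≃-sym (ℚP.toℚᵘ-homo-* (ℕtoℚ m) (ℕtoℚ n)) ⟩
  ℚ.toℚᵘ (ℕtoℚ m ℚ.* ℕtoℚ n)                  ∎)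
  where open UP.≃-Reasoning

ℕtoℚ-injective : ∀ {m n} → ℕtoℚ m ≡ ℕtoℚ n → m ≡ n
ℕtoℚ-injective {m} {n} eq = cong (ℤ.∣_∣ ∘ ℚ.↥_) (trans (sym (ℕtoℚ-mkℚ m)) (trans eq (ℕtoℚ-mkℚ n)))

ℕtoℚ-nonZero : ∀ m → .{{ℕ.NonZero m}} → ℚ.NonZero (ℕtoℚ m)
ℕtoℚ-nonZero (suc m) rewrite ℕtoℚ-mkℚ (suc m) = _

1/! : ℕ → ℚ
1/! i = ℚ.1/_ (ℕtoℚ (i !)) {{ℕtoℚ-nonZero (i !) {{ℕP._!≢0 i}}}}

!*1/! : ∀ i → ℕtoℚ (i !) ℚ.* 1/! i ≡ 1ℚ
!*1/! i = ℚP.*-inverseʳ (ℕtoℚ (i !)) {{ℕtoℚ-nonZero (i !) {{ℕP._!≢0 i}}}}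

addConst : ∀ {n} → ℚ → Vec ℚ (suc n) → Vec ℚ (suc n)
addConst c (c₀ ∷ cs) = (c ℚ.+ c₀) ∷ cs

evalPoly-addConst : ∀ {n} c (cs : Vec ℚ (suc n)) x → evalPoly (addConst c cs) x ≡ c ℚ.+ evalPoly cs x
evalPoly-addConst c (c₀ ∷ cs) x = ℚP.+-assoc c c₀ _

last-addConst : ∀ {n} c (cs : Vec ℚ (suc (suc n))) → last (addConst c cs) ≡ last cs
last-addConst c (c₀ ∷ c₁ ∷ cs) = refl

-- Multiplying a polynomial by the linear factor x − r, using
--   (x − r) (c₀ + x q) = − r c₀ + x (c₀ + (x − r) q).
mulLinear : ∀ {n} → Vec ℚ (suc n) → ℚ → Vec ℚ (suc (suc n))
mulLinear (c₀ ∷ []) r = ℚ.- (r ℚ.* c₀) ∷ c₀ ∷ []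
mulLinear (c₀ ∷ c₁ ∷ cs) r = ℚ.- (r ℚ.* c₀) ∷ addConst c₀ (mulLinear (c₁ ∷ cs) r)

evalPoly-mulLinear : ∀ {n} (cs : Vec ℚ (suc n)) r x → evalPoly (mulLinear cs r) x ≡ (x ℚ.- r) ℚ.* evalPoly cs x
evalPoly-mulLinear (c₀ ∷ []) r x =
  QS.solve 3 (λ x r c → (:- (r :* c)) :+ x :* (c :+ x :* con 0ℚ) := (x :- r) :* (c :+ x :* con 0ℚ)) refl x r c₀
  where open QS using (_:+_; _:*_; _:-_; :-_; _:=_; con)
evalPoly-mulLinear (c₀ ∷ c₁ ∷ cs) r x = begin
    ℚ.- (r ℚ.* c₀) ℚ.+ x ℚ.* evalPoly (addConst c₀ (mulLinear (c₁ ∷ cs) r)) x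
  ≡⟨ cong (λ z → ℚ.- (r ℚ.* c₀) ℚ.+ x ℚ.* z)
          (trans (evalPoly-addConst c₀ (mulLinear (c₁ ∷ cs) r) x) (cong (c₀ ℚ.+_) (evalPoly-mulLinear (c₁ ∷ cs) r x))) ⟩
    ℚ.- (r ℚ.* c₀) ℚ.+ x ℚ.* (c₀ ℚ.+ (x ℚ.- r) ℚ.* q)
  ≡⟨ QS.solve 4 (λ x r c q → (:- (r :* c)) :+ x :* (c :+ (x :- r) :* q) := (x :- r) :* (c :+ x :* q)) refl x r c₀ q ⟩
    (x ℚ.- r) ℚ.* (c₀ ℚ.+ x ℚ.* q)
  ∎
  where
  open ≡-Reasoning
  open QS using (_:+_; _:*_; _:-_; :-_; _:=_)
  q : ℚ
  q = evalPoly (c₁ ∷ cs) x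

last-mulLinear : ∀ {n} (cs : Vec ℚ (suc n)) r → last (mulLinear cs r) ≡ last cs
last-mulLinear (c₀ ∷ []) r = refl
last-mulLinear (c₀ ∷ c₁ ∷ cs) r = trans (last-addConst c₀ (mulLinear (c₁ ∷ cs) r)) (last-mulLinear (c₁ ∷ cs) r)

falling : ℕ → ℕ → ℕ
falling d zero = 1
falling d (suc i) = falling d i * (d ∸ i)

falling-vanishes : ∀ {d i} → d < i → falling d i ≡ 0
falling-vanishes {d} {suc i} (s≤s d≤i) with ℕP.m≤n⇒m<n∨m≡n d≤i
... | inj₁ d<i = cong (_* (d ∸ i)) (falling-vanishes d<i)
... | inj₂ refl = trans (cong (falling d d *_) (ℕP.n∸n≡0 d)) (ℕP.*-zeroʳ (falling d d))

falling-suc : ∀ d i → falling (suc d) (suc i) ≡ suc d * falling d i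
falling-suc d zero = trans (ℕP.*-identityˡ (suc d)) (sym (ℕP.*-identityʳ (suc d)))
falling-suc d (suc i) = trans (cong (_* (d ∸ i)) (falling-suc d i)) (ℕP.*-assoc (suc d) (falling d i) (d ∸ i))

-- (i + 1 + (d − i)) · falling d i = (d + 1) · falling d i, also when d < i (both sides vanish).
falling-absorb : ∀ d i → falling d i * (suc i + (d ∸ i)) ≡ suc d * falling d i
falling-absorb d i with ℕP.≤-<-connex i d
... | inj₁ i≤d = trans (cong (λ m → falling d i * suc m) (ℕP.m+[n∸m]≡n i≤d)) (ℕP.*-comm (falling d i) (suc d))
... | inj₂ d<i rewrite falling-vanishes d<i = sym (ℕP.*-zeroʳ (suc d))

choose-falling : ∀ d i → choose d i * i ! ≡ falling d i
choose-falling zero zero = refl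
choose-falling zero (suc i) = sym (trans (cong (falling 0 i *_) (ℕP.0∸n≡0 i)) (ℕP.*-zeroʳ (falling 0 i)))
choose-falling (suc d) zero = refl
choose-falling (suc d) (suc i) = begin
    (choose d i + choose d (suc i)) * (suc i * i !)
  ≡⟨ ℕP.*-distribʳ-+ (suc i * i !) (choose d i) (choose d (suc i)) ⟩
    choose d i * (suc i * i !) + choose d (suc i) * (suc i * i !)
  ≡⟨ cong (_+ choose d (suc i) * (suc i * i !))
          (NS.solve 3 (λ c s f → c :* (s :* f) := (c :* f) :* s) refl (choose d i) (suc i) (i !)) ⟩
    choose d i * i ! * suc i + choose d (suc i) * (suc i * i !)
  ≡⟨ cong₂ _+_ (cong (_* suc i) (choose-falling d i)) (choose-falling d (suc i)) ⟩
    falling d i * suc i + falling d i * (d ∸ i)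
  ≡⟨ sym (ℕP.*-distribˡ-+ (falling d i) (suc i) (d ∸ i)) ⟩
    falling d i * (suc i + (d ∸ i))
  ≡⟨ falling-absorb d i ⟩
    suc d * falling d i
  ≡⟨ sym (falling-suc d i) ⟩
    falling (suc d) (suc i)
  ∎
  where
  open ≡-Reasoning
  open NS using (_:*_; _:=_)

-- The recursion of falling factorials read in ℚ, where d − i may be negative.
falling-step : ∀ d i → ℕtoℚ (falling d i) ℚ.* (ℕtoℚ d ℚ.- ℕtoℚ i) ≡ ℕtoℚ (falling d (suc i))
falling-step d i with ℕP.≤-<-connex i d
... | inj₁ i≤d = begin
    ℕtoℚ (falling d i) ℚ.* (ℕtoℚ d ℚ.- ℕtoℚ i)
  ≡⟨ cong (λ z → ℕtoℚ (falling d i) ℚ.* (z ℚ.- ℕtoℚ i))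
          (trans (cong ℕtoℚ (sym (ℕP.m+[n∸m]≡n i≤d))) (ℕtoℚ-+ i (d ∸ i))) ⟩
    ℕtoℚ (falling d i) ℚ.* ((ℕtoℚ i ℚ.+ ℕtoℚ (d ∸ i)) ℚ.- ℕtoℚ i)
  ≡⟨ QS.solve 3 (λ f a b → f :* ((a :+ b) :- a) := f :* b) refl (ℕtoℚ (falling d i)) (ℕtoℚ i) (ℕtoℚ (d ∸ i)) ⟩
    ℕtoℚ (falling d i) ℚ.* ℕtoℚ (d ∸ i)
  ≡⟨ sym (ℕtoℚ-* (falling d i) (d ∸ i)) ⟩
    ℕtoℚ (falling d (suc i))
  ∎
  where
  open ≡-Reasoning
  open QS using (_:+_; _:*_; _:-_; _:=_)
... | inj₂ d<i rewrite falling-vanishes d<i = ℚP.*-zeroˡ (ℕtoℚ d ℚ.- ℕtoℚ i)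

-- For a sequence a of naturals put  cᵢ = aᵢ / i!  and
--   newton i r = cᵢ + (x − i)(cᵢ₊₁ + (x − i − 1)(⋯ (x − i − r + 1) cᵢ₊ᵣ)),
-- a polynomial of degree r with top coefficient cᵢ₊ᵣ.  Since falling d i · (d − i) = falling d (i + 1)
-- and falling d j · cⱼ = C(d, j) aⱼ, it evaluates at x = d to a truncated binomial transform of a.
module Newton (a : ℕ → ℕ) where

  coefficient : ℕ → ℚ
  coefficient i = ℕtoℚ (a i) ℚ.* 1/! i

  newton : ℕ → (r : ℕ) → Vec ℚ (suc r)
  newton i zero = coefficient i ∷ []
  newton i (suc r) = addConst (coefficient i) (mulLinear (newton (suc i) r) (ℕtoℚ i))

  last-newton : ∀ i r → last (newton i r) ≡ coefficient (i + r)
  last-newton i zero = cong coefficient (sym (ℕP.+-identityʳ i))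
  last-newton i (suc r) = begin
    last (addConst (coefficient i) (mulLinear (newton (suc i) r) (ℕtoℚ i)))
      ≡⟨ last-addConst (coefficient i) (mulLinear (newton (suc i) r) (ℕtoℚ i)) ⟩
    last (mulLinear (newton (suc i) r) (ℕtoℚ i))  ≡⟨ last-mulLinear (newton (suc i) r) (ℕtoℚ i) ⟩
    last (newton (suc i) r)                       ≡⟨ last-newton (suc i) r ⟩
    coefficient (suc i + r)                       ≡⟨ cong coefficient (sym (ℕP.+-suc i r)) ⟩
    coefficient (i + suc r)                       ∎
    where open ≡-Reasoning

  falling-coefficient : ∀ d i → ℕtoℚ (falling d i) ℚ.* coefficient i ≡ ℕtoℚ (choose d i * a i)
  falling-coefficient d i = begin
      ℕtoℚ (falling d i) ℚ.* (A ℚ.* I)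
    ≡⟨ cong (λ z → ℕtoℚ z ℚ.* (A ℚ.* I)) (sym (choose-falling d i)) ⟩
      ℕtoℚ (choose d i * i !) ℚ.* (A ℚ.* I)
    ≡⟨ cong (ℚ._* (A ℚ.* I)) (ℕtoℚ-* (choose d i) (i !)) ⟩
      (C ℚ.* F) ℚ.* (A ℚ.* I)
    ≡⟨ QS.solve 4 (λ C F A I → (C :* F) :* (A :* I) := (C :* A) :* (F :* I)) refl C F A I ⟩
      (C ℚ.* A) ℚ.* (F ℚ.* I)
    ≡⟨ trans (cong ((C ℚ.* A) ℚ.*_) (!*1/! i)) (ℚP.*-identityʳ (C ℚ.* A)) ⟩
      C ℚ.* A
    ≡⟨ sym (ℕtoℚ-* (choose d i) (a i)) ⟩
      ℕtoℚ (choose d i * a i)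
    ∎
    where
    open ≡-Reasoning
    open QS using (_:*_; _:=_)
    A I C F : ℚ
    A = ℕtoℚ (a i)
    I = 1/! i
    C = ℕtoℚ (choose d i)
    F = ℕtoℚ (i !)

  shiftedSum : ℕ → ℕ → ℕ → ℕ
  shiftedSum d i r = sumTo (suc r) (λ j → choose d (i + j) * a (i + j))

  shiftedSum-suc : ∀ d i r → shiftedSum d i (suc r) ≡ choose d i * a i + shiftedSum d (suc i) r
  shiftedSum-suc d i r = cong₂ _+_ (cong (λ m → choose d m * a m) (ℕP.+-identityʳ i))
                             (sumTo-cong (suc r) (λ j → cong (λ m → choose d m * a m) (ℕP.+-suc i j)))

  newton-eval : ∀ r i d → ℕtoℚ (falling d i) ℚ.* evalPoly (newton i r) (ℕtoℚ d) ≡ ℕtoℚ (shiftedSum d i r)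
  newton-eval zero i d = begin
      ℕtoℚ (falling d i) ℚ.* (coefficient i ℚ.+ ℕtoℚ d ℚ.* 0ℚ)
    ≡⟨ cong (λ z → ℕtoℚ (falling d i) ℚ.* z) (trans (cong (coefficient i ℚ.+_) (ℚP.*-zeroʳ (ℕtoℚ d))) (ℚP.+-identityʳ _)) ⟩
      ℕtoℚ (falling d i) ℚ.* coefficient i
    ≡⟨ falling-coefficient d i ⟩
      ℕtoℚ (choose d i * a i)
    ≡⟨ cong ℕtoℚ (trans (cong (λ m → choose d m * a m) (sym (ℕP.+-identityʳ i))) (sym (ℕP.+-identityʳ _))) ⟩
      ℕtoℚ (shiftedSum d i zero)
    ∎
    where open ≡-Reasoning
  newton-eval (suc r) i d = begin
      F ℚ.* evalPoly (addConst (coefficient i) (mulLinear (newton (suc i) r) (ℕtoℚ i))) x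
    ≡⟨ cong (F ℚ.*_) (trans (evalPoly-addConst (coefficient i) (mulLinear (newton (suc i) r) (ℕtoℚ i)) x)
                             (cong (coefficient i ℚ.+_) (evalPoly-mulLinear (newton (suc i) r) (ℕtoℚ i) x))) ⟩
      F ℚ.* (coefficient i ℚ.+ (x ℚ.- ℕtoℚ i) ℚ.* E)
    ≡⟨ QS.solve 5 (λ F c x y E → F :* (c :+ (x :- y) :* E) := F :* c :+ (F :* (x :- y)) :* E) refl
                  F (coefficient i) x (ℕtoℚ i) E ⟩
      F ℚ.* coefficient i ℚ.+ (F ℚ.* (x ℚ.- ℕtoℚ i)) ℚ.* E
    ≡⟨ cong₂ ℚ._+_ (falling-coefficient d i) (trans (cong (ℚ._* E) (falling-step d i)) (newton-eval r (suc i) d)) ⟩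
      ℕtoℚ (choose d i * a i) ℚ.+ ℕtoℚ (shiftedSum d (suc i) r)
    ≡⟨ sym (ℕtoℚ-+ (choose d i * a i) (shiftedSum d (suc i) r)) ⟩
      ℕtoℚ (choose d i * a i + shiftedSum d (suc i) r)
    ≡⟨ cong ℕtoℚ (sym (shiftedSum-suc d i r)) ⟩
      ℕtoℚ (shiftedSum d i (suc r))
    ∎
    where
    open ≡-Reasoning
    open QS using (_:+_; _:*_; _:-_; _:=_)
    F x E : ℚ
    F = ℕtoℚ (falling d i)
    x = ℕtoℚ d
    E = evalPoly (newton (suc i) r) x

  binomial-polynomial : ∀ D → 1 ≤ a D → Σ (Vec ℚ (suc D)) λ cs → (¬ last cs ≡ 0ℚ) ×
                        (∀ d → evalPoly cs (ℕtoℚ d) ≡ ℕtoℚ (sumTo (suc D) (λ j → choose d j * a j)))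
  binomial-polynomial D 1≤aD = newton 0 D , top≢0 , λ d → trans (sym (ℚP.*-identityˡ _)) (newton-eval D 0 d)
    where
    top≢0 : ¬ last (newton 0 D) ≡ 0ℚ
    top≢0 top≡0 = ℕP.<-irrefl (sym (ℕtoℚ-injective aD≡0)) 1≤aD
      where
      open ≡-Reasoning
      aD≡0 : ℕtoℚ (a D) ≡ ℕtoℚ 0
      aD≡0 = begin
        ℕtoℚ (a D)                                  ≡⟨ sym (ℚP.*-identityʳ _) ⟩
        ℕtoℚ (a D) ℚ.* 1ℚ                           ≡⟨ cong (ℕtoℚ (a D) ℚ.*_) (sym (trans (ℚP.*-comm (1/! D) _) (!*1/! D))) ⟩
        ℕtoℚ (a D) ℚ.* (1/! D ℚ.* ℕtoℚ (D !))        ≡⟨ sym (ℚP.*-assoc (ℕtoℚ (a D)) (1/! D) _) ⟩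
        coefficient D ℚ.* ℕtoℚ (D !)                ≡⟨ cong (ℚ._* ℕtoℚ (D !)) (trans (sym (last-newton 0 D)) top≡0) ⟩
        0ℚ ℚ.* ℕtoℚ (D !)                           ≡⟨ ℚP.*-zeroˡ (ℕtoℚ (D !)) ⟩
        0ℚ                                          ∎

theorem2 : (t : Kind) (v : ℕ) → 1 ≤ v →
    Σ (Vec ℚ (suc ⌊log₂ v ⌋)) λ cs →
    (¬ last cs ≡ 0ℚ) ×
    ((d : ℕ) → Σ ℕ λ N → (Fin N ↔ Structure t d v) × (evalPoly cs (ℕtoℚ d) ≡ ℕtoℚ N))
theorem2 t v v≥1 =
  let cs , top≢0 , evaluates = binomial-polynomial ⌊log₂ v ⌋ a-top-positive
  in cs , top≢0 , λ d → binomialSum d 0 , count d , evaluates d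
  where
  open Counting t v v≥1
  open Newton a using (binomial-polynomial)
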